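{- Let $G$ be a connected claw-$o_{ -1}$-heavy graph on $n$ vertices and let $x$ be a cut-vertex of $G$. Then (1) $G-x$ has exactly two components; and (2) if $x_1$ and $x_2$ are two neighbors of $x$ lying in a common component of $G-x$, then either $x_1x_2\in E(G)$ or $d(x_1)+d(x_2)\ge n-1$.
   Context: All graphs are finite and simple; $d(v)$ is the degree of $v$ in $G$. A claw is $K_{1,3}$. A graph $G$ on $n$ vertices is claw-$o_{ -1}$-heavy if every induced subgraph of $G$ isomorphic to $K_{1,3}$ contains two nonadjacent vertices whose degree sum in $G$ is at least $n-1$. -}

module Defs where

open import Data.Nat using (ℕ; _+_; _∸_; _≤_)
open import Data.Fin using (Fin)
open import Data.Bool using (Bool; true; false; if_then_else_)
open import Data.List using (List; map; allFin)
open import Data.Nat.ListAction using (sum)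
open import Data.Product using (Σ; ∃; ∃-syntax; _×_; _,_)
open import Data.Sum using (_⊎_)
open import Data.Unit using (⊤)
open import Relation.Nullary using (¬_)
open import Relation.Binary.PropositionalEquality using (_≡_; _≢_)

record Graph (n : ℕ) : Set where
  field
    adj    : Fin n → Fin n → Bool
    sym    : ∀ u v → adj u v ≡ adj v u
    irrefl : ∀ u → adj u u ≡ false

open Graph public

module _ {n : ℕ} (G : Graph n) where

  Adj : Fin n → Fin n → Set
  Adj u v = adj G u v ≡ true

  deg : Fin n → ℕ
  deg u = sum (map (λ v → if adj G u v then 1 else 0) (allFin n))

  data WalkIn (P : Fin n → Set) : Fin n → Fin n → Set where
    here : ∀ {u} → P u → WalkIn P u u
    step : ∀ {u w v} → P u → Adj u w → WalkIn P w v → WalkIn P u v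

  Connected : Set
  Connected = ∀ u v → WalkIn (λ _ → ⊤) u v

  SameCompMinus : Fin n → Fin n → Fin n → Set
  SameCompMinus x u v = WalkIn (λ w → w ≢ x) u v

  CutVertex : Fin n → Set
  CutVertex x = ∃[ u ] ∃[ v ] (u ≢ x × v ≢ x × ¬ SameCompMinus x u v)

  TwoComponentsMinus : Fin n → Set
  TwoComponentsMinus x =
    ∃[ a ] ∃[ b ] (a ≢ x × b ≢ x × ¬ SameCompMinus x a b ×
      (∀ v → v ≢ x → SameCompMinus x a v ⊎ SameCompMinus x b v))

  InducedClaw : Fin n → Fin n → Fin n → Fin n → Set
  InducedClaw c a b d =
    a ≢ b × a ≢ d × b ≢ d ×
    Adj c a × Adj c b × Adj c d ×
    ¬ Adj a b × ¬ Adj a d × ¬ Adj b d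

  Heavy : Fin n → Fin n → Set
  Heavy u v = n ∸ 1 ≤ deg u + deg v

  -- every induced claw has two nonadjacent vertices (necessarily two leaves)
  -- with degree sum ≥ n - 1
  ClawO-1Heavy : Set
  ClawO-1Heavy = ∀ c a b d → InducedClaw c a b d →
    Heavy a b ⊎ Heavy a d ⊎ Heavy b d

-- If three neighbours a, b, c of a cut-vertex x lay in pairwise different
-- components of G − x, they would be the leaves of an induced claw centred at x.
-- Two of them, say a and b, have no common neighbour besides x, and N(a), N(b)
-- avoid a, b and c, so d(a) + d(b) ≤ (n − 3) + 1: no pair of leaves is heavy. Likewise two nonadjacent neighbours
-- x₁, x₂ of x on one side and a neighbour y of x on the other side form an
-- induced claw in which x₁y and x₂y are light, so x₁x₂ must be heavy.
-- The counting only uses that the leaves are at distance more than two in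
-- G − x, which, unlike lying in different components, is decidable here.
module Submission where

open import Defs hiding (sym)
open import Data.Bool using (true; false; if_then_else_)
import Data.Bool.Properties as Bool
open import Data.Empty using (⊥-elim)
open import Data.Fin using (Fin; zero; suc)
open import Data.Fin.Properties using (_≟_; any?)
open import Data.List using (tabulate)
open import Data.List.Properties using (map-tabulate)
import Data.Nat.ListAction as List
open import Data.Nat using (ℕ; zero; suc; _+_; _∸_; _≤_; z≤n; s≤s; s≤s⁻¹)
open import Data.Nat.Properties
  using (+-0-commutativeMonoid; +-mono-≤; ≤-refl; <⇒≱; module ≤-Reasoning)
open import Algebra.Properties.CommutativeMonoid.Sum +-0-commutativeMonoid
  using (sum; ∑-distrib-+; sum-replicate-zero)
open import Data.Product using (∃-syntax; _×_; _,_)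
open import Data.Sum using (_⊎_; inj₁; inj₂; [_,_]′)
open import Data.Unit using (⊤)
open import Function using (_∘_; id)
open import Relation.Nullary using (¬_; Dec; yes; no; does; contradiction)
open import Relation.Nullary.Decidable using (¬?; _×-dec_; _⊎-dec_; dec-false)
open import Relation.Binary.PropositionalEquality
  using (_≡_; _≢_; refl; sym; trans; cong; cong₂; subst; ≢-sym)

sum-mono-≤ : ∀ {n} {f g : Fin n → ℕ} → (∀ v → f v ≤ g v) → sum f ≤ sum g
sum-mono-≤ {zero}  f≤g = z≤n
sum-mono-≤ {suc n} f≤g = +-mono-≤ (f≤g zero) (sum-mono-≤ (f≤g ∘ suc))

sum-const-1 : ∀ n → sum {n} (λ _ → 1) ≡ n
sum-const-1 zero    = refl
sum-const-1 (suc n) = cong suc (sum-const-1 n)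

sum-tabulate : ∀ {n} (f : Fin n → ℕ) → List.sum (tabulate f) ≡ sum f
sum-tabulate {zero}  f = refl
sum-tabulate {suc n} f = cong (f zero +_) (sum-tabulate (f ∘ suc))

δ : ∀ {n} → Fin n → Fin n → ℕ
δ a v = if does (v ≟ a) then 1 else 0

δ-off : ∀ {n} {a v : Fin n} → v ≢ a → δ a v ≡ 0
δ-off {a = a} {v} v≢a rewrite dec-false (v ≟ a) v≢a = refl

sum-δ : ∀ {n} (a : Fin n) → sum (δ a) ≡ 1
sum-δ {suc n} zero    = cong suc (sum-replicate-zero n)
sum-δ {suc n} (suc a) = sum-δ a

2+sum≤n : ∀ {n} (f : Fin n → ℕ) {x a b c : Fin n} →
  a ≢ b → a ≢ c → b ≢ c → a ≢ x → b ≢ x → c ≢ x →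
  f a ≡ 0 → f b ≡ 0 → f c ≡ 0 → f x ≤ 2 → (∀ v → v ≢ x → f v ≤ 1) →
  2 + sum f ≤ n
2+sum≤n {n} f {x} {a} {b} {c} a≢b a≢c b≢c a≢x b≢x c≢x fa fb fc fx≤2 f≤1 =
  s≤s⁻¹ (begin
    3 + sum f
      ≡⟨ cong (_+ sum f) (cong₂ _+_ (cong₂ _+_ (sum-δ a) (sum-δ b)) (sum-δ c)) ⟨
    sum (δ a) + sum (δ b) + sum (δ c) + sum f
      ≡⟨ cong (λ s → s + sum (δ c) + sum f) (∑-distrib-+ (δ a) (δ b)) ⟨
    sum (λ v → δ a v + δ b v) + sum (δ c) + sum f
      ≡⟨ cong (_+ sum f) (∑-distrib-+ _ (δ c)) ⟨
    sum (λ v → δ a v + δ b v + δ c v) + sum f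
      ≡⟨ ∑-distrib-+ _ f ⟨
    sum (λ v → δ a v + δ b v + δ c v + f v)
      ≤⟨ sum-mono-≤ pointwise ⟩
    sum (λ v → δ x v + 1)
      ≡⟨ ∑-distrib-+ (δ x) _ ⟩
    sum (δ x) + sum {n} (λ _ → 1)
      ≡⟨ cong₂ _+_ (sum-δ x) (sum-const-1 n) ⟩
    1 + n ∎)
  where
  open ≤-Reasoning
  -- Each `with v ≟ p` also evaluates δ p v, so only the remaining δ's are rewritten.
  pointwise : ∀ v → δ a v + δ b v + δ c v + f v ≤ δ x v + 1
  pointwise v with v ≟ x
  ... | yes refl
      rewrite δ-off (≢-sym a≢x) | δ-off (≢-sym b≢x) | δ-off (≢-sym c≢x) = fx≤2
  ... | no v≢x with v ≟ a
  ...   | yes refl rewrite δ-off a≢b | δ-off a≢c | fa = ≤-refl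
  ...   | no _ with v ≟ b
  ...     | yes refl rewrite δ-off b≢c | fb = ≤-refl
  ...     | no _ with v ≟ c
  ...       | yes refl rewrite fc = ≤-refl
  ...       | no _ = f≤1 v v≢x

2+m≤n⇒n∸1≰m : ∀ {m n} → 2 + m ≤ n → ¬ (n ∸ 1 ≤ m)
2+m≤n⇒n∸1≰m {n = suc n} (s≤s 1+m≤n) = <⇒≱ 1+m≤n

module _ {n : ℕ} (G : Graph n) where

  private variable
    u v : Fin n

  adj? : ∀ u v → Dec (Adj G u v)
  adj? u v = adj G u v Bool.≟ true

  adj-sym : Adj G u v → Adj G v u
  adj-sym {u} {v} u~v = trans (Graph.sym G v u) u~v

  ¬adj-sym : ¬ Adj G u v → ¬ Adj G v u
  ¬adj-sym u≁v = u≁v ∘ adj-sym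

  adj-irrefl : ¬ Adj G u u
  adj-irrefl {u} u~u with () ← trans (sym (Graph.irrefl G u)) u~u

  adj⇒≢ : Adj G u v → v ≢ u
  adj⇒≢ u~u refl = adj-irrefl u~u

  nbr : Fin n → Fin n → ℕ
  nbr u v = if adj G u v then 1 else 0

  nbr≤1 : nbr u v ≤ 1
  nbr≤1 {u} {v} with adj G u v
  ... | true  = ≤-refl
  ... | false = z≤n

  nbr-¬adj : ¬ Adj G u v → nbr u v ≡ 0
  nbr-¬adj {u} {v} u≁v with adj G u v
  ... | true  = contradiction refl u≁v
  ... | false = refl

  deg≡sum-nbr : deg G u ≡ sum (nbr u)
  deg≡sum-nbr {u} = trans (cong List.sum (map-tabulate id (nbr u))) (sum-tabulate (nbr u))

module _ {n : ℕ} {G : Graph n} {P : Fin n → Set} where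

  private variable
    u v w : Fin n

  infixr 5 _++ʷ_

  _++ʷ_ : WalkIn G P u v → WalkIn G P v w → WalkIn G P u w
  here _        ++ʷ q = q
  step pu u~v p ++ʷ q = step pu u~v (p ++ʷ q)

  walk-start : WalkIn G P u v → P u
  walk-start (here pu)     = pu
  walk-start (step pu _ _) = pu

  walk-reverse : WalkIn G P u v → WalkIn G P v u
  walk-reverse (here pu)       = here pu
  walk-reverse (step pu u~w p) = walk-reverse p ++ʷ step (walk-start p) (adj-sym G u~w) (here pu)

module _ {n : ℕ} (G : Graph n) where

  private variable
    x a b c u w : Fin n

  walk-to-neighbour : u ≢ x → WalkIn G (λ _ → ⊤) u x →
    ∃[ y ] (Adj G x y × SameCompMinus G x u y)
  walk-to-neighbour u≢x (here _) = contradiction refl u≢x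
  walk-to-neighbour {u} {x} u≢x (step {w = w} _ u~w w⇝x) with w ≟ x
  ... | yes refl = u , adj-sym G u~w , here u≢x
  ... | no w≢x with walk-to-neighbour w≢x w⇝x
  ...   | y , x~y , w⇝y = y , x~y , step u≢x u~w w⇝y

  Near : Fin n → Fin n → Fin n → Set
  Near x a b = a ≡ b ⊎ Adj G a b ⊎ ∃[ v ] (v ≢ x × Adj G a v × Adj G v b)

  near? : ∀ x a b → Dec (Near x a b)
  near? x a b =
    a ≟ b ⊎-dec adj? G a b ⊎-dec any? (λ v → ¬? (v ≟ x) ×-dec adj? G a v ×-dec adj? G v b)

  near-sym : Near x a b → Near x b a
  near-sym (inj₁ refl)       = inj₁ refl
  near-sym (inj₂ (inj₁ a~b)) = inj₂ (inj₁ (adj-sym G a~b))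
  near-sym (inj₂ (inj₂ (v , v≢x , a~v , v~b))) =
    inj₂ (inj₂ (v , v≢x , adj-sym G v~b , adj-sym G a~v))

  near⇒same : a ≢ x → b ≢ x → Near x a b → SameCompMinus G x a b
  near⇒same a≢x b≢x (inj₁ refl)       = here a≢x
  near⇒same a≢x b≢x (inj₂ (inj₁ a~b)) = step a≢x a~b (here b≢x)
  near⇒same a≢x b≢x (inj₂ (inj₂ (v , v≢x , a~v , v~b))) =
    step a≢x a~v (step v≢x v~b (here b≢x))

  ¬same⇒far : a ≢ x → b ≢ x → ¬ SameCompMinus G x a b → ¬ Near x a b
  ¬same⇒far a≢x b≢x a∤b = a∤b ∘ near⇒same a≢x b≢x

  far⇒≢ : ¬ Near x a b → a ≢ b
  far⇒≢ far = far ∘ inj₁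

  far⇒¬adj : ¬ Near x a b → ¬ Adj G a b
  far⇒¬adj far = far ∘ inj₂ ∘ inj₁

  far-degree-sum : a ≢ x → b ≢ x → c ≢ x → ¬ Near x a b →
    a ≢ c → b ≢ c → ¬ Adj G a c → ¬ Adj G b c → 2 + (deg G a + deg G b) ≤ n
  far-degree-sum {a} {x} {b} {c} a≢x b≢x c≢x far a≢c b≢c a≁c b≁c =
    subst (λ s → 2 + s ≤ n) deg-sum
      (2+sum≤n f (far⇒≢ far) a≢c b≢c a≢x b≢x c≢x
        (cong₂ _+_ (nbr-¬adj G (adj-irrefl G)) (nbr-¬adj G (¬adj-sym G (far⇒¬adj far))))
        (cong₂ _+_ (nbr-¬adj G (far⇒¬adj far)) (nbr-¬adj G (adj-irrefl G)))
        (cong₂ _+_ (nbr-¬adj G a≁c) (nbr-¬adj G b≁c))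
        (+-mono-≤ (nbr≤1 G) (nbr≤1 G))
        no-common-neighbour)
    where
    f : Fin n → ℕ
    f v = nbr G a v + nbr G b v
    deg-sum : sum f ≡ deg G a + deg G b
    deg-sum = trans (∑-distrib-+ (nbr G a) (nbr G b))
                    (sym (cong₂ _+_ (deg≡sum-nbr G) (deg≡sum-nbr G)))
    no-common-neighbour : ∀ v → v ≢ x → f v ≤ 1
    no-common-neighbour v v≢x with adj G a v in a~v | adj G b v in b~v
    ... | true  | true  = contradiction (inj₂ (inj₂ (v , v≢x , a~v , adj-sym G b~v))) far
    ... | true  | false = ≤-refl
    ... | false | true  = ≤-refl
    ... | false | false = z≤n

  far⇒¬heavy : a ≢ x → b ≢ x → c ≢ x → ¬ Near x a b →
    a ≢ c → b ≢ c → ¬ Adj G a c → ¬ Adj G b c → ¬ Heavy G a b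
  far⇒¬heavy a≢x b≢x c≢x far a≢c b≢c a≁c b≁c =
    2+m≤n⇒n∸1≰m (far-degree-sum a≢x b≢x c≢x far a≢c b≢c a≁c b≁c)

  claw-heavy-pair : ClawO-1Heavy G → Adj G x a → Adj G x b → Adj G x c →
    a ≢ b → ¬ Adj G a b → ¬ Near x a c → ¬ Near x b c → Heavy G a b
  claw-heavy-pair {x} {a} {b} {c} H x~a x~b x~c a≢b a≁b far-ac far-bc =
    [ id , [ ⊥-elim ∘ ¬heavy-ac , ⊥-elim ∘ ¬heavy-bc ]′ ]′
      (H x a b c (a≢b , far⇒≢ far-ac , far⇒≢ far-bc , x~a , x~b , x~c ,
                  a≁b , far⇒¬adj far-ac , far⇒¬adj far-bc))
    where
    ¬heavy-ac : ¬ Heavy G a c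
    ¬heavy-ac = far⇒¬heavy (adj⇒≢ G x~a) (adj⇒≢ G x~c) (adj⇒≢ G x~b) far-ac
      a≢b (≢-sym (far⇒≢ far-bc)) a≁b (¬adj-sym G (far⇒¬adj far-bc))
    ¬heavy-bc : ¬ Heavy G b c
    ¬heavy-bc = far⇒¬heavy (adj⇒≢ G x~b) (adj⇒≢ G x~c) (adj⇒≢ G x~a) far-bc
      (≢-sym a≢b) (≢-sym (far⇒≢ far-ac)) (¬adj-sym G a≁b) (¬adj-sym G (far⇒¬adj far-ac))

  module Sides (H : ClawO-1Heavy G) (conn : Connected G)
    (x~a : Adj G x a) (x~b : Adj G x b) (a∤b : ¬ SameCompMinus G x a b) where

    neighbour-side : Adj G x w → SameCompMinus G x a w ⊎ SameCompMinus G x b w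
    neighbour-side {w} x~w with near? x a w | near? x b w
    ... | yes near-aw | _           = inj₁ (near⇒same (adj⇒≢ G x~a) (adj⇒≢ G x~w) near-aw)
    ... | no _        | yes near-bw = inj₂ (near⇒same (adj⇒≢ G x~b) (adj⇒≢ G x~w) near-bw)
    ... | no far-aw   | no far-bw   = ⊥-elim (¬heavy-aw heavy-aw)
      where
      far-ab : ¬ Near x a b
      far-ab = ¬same⇒far (adj⇒≢ G x~a) (adj⇒≢ G x~b) a∤b
      far-wb : ¬ Near x w b
      far-wb = far-bw ∘ near-sym
      heavy-aw : Heavy G a w
      heavy-aw = claw-heavy-pair H x~a x~w x~b (far⇒≢ far-aw) (far⇒¬adj far-aw) far-ab far-wb
      ¬heavy-aw : ¬ Heavy G a w
      ¬heavy-aw = far⇒¬heavy (adj⇒≢ G x~a) (adj⇒≢ G x~w) (adj⇒≢ G x~b) far-aw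
        (far⇒≢ far-ab) (far⇒≢ far-wb) (far⇒¬adj far-ab) (far⇒¬adj far-wb)

    side : ∀ w → w ≢ x → SameCompMinus G x a w ⊎ SameCompMinus G x b w
    side w w≢x with walk-to-neighbour w≢x (conn w x)
    ... | y , x~y , w⇝y with neighbour-side x~y
    ...   | inj₁ a⇝y = inj₁ (a⇝y ++ʷ walk-reverse w⇝y)
    ...   | inj₂ b⇝y = inj₂ (b⇝y ++ʷ walk-reverse w⇝y)

    opposite-neighbour : w ≢ x → ∃[ y ] (Adj G x y × ¬ SameCompMinus G x w y)
    opposite-neighbour {w} w≢x with side w w≢x
    ... | inj₁ a⇝w = b , x~b , λ w⇝b → a∤b (a⇝w ++ʷ w⇝b)
    ... | inj₂ b⇝w = a , x~a , λ w⇝a → a∤b (walk-reverse (b⇝w ++ʷ w⇝a))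

    adjacent-or-heavy : ∀ x₁ x₂ → x₁ ≢ x₂ → Adj G x x₁ → Adj G x x₂ →
      SameCompMinus G x x₁ x₂ → Adj G x₁ x₂ ⊎ Heavy G x₁ x₂
    adjacent-or-heavy x₁ x₂ x₁≢x₂ x~x₁ x~x₂ x₁⇝x₂ with adj? G x₁ x₂
    ... | yes x₁~x₂ = inj₁ x₁~x₂
    ... | no x₁≁x₂ with opposite-neighbour (adj⇒≢ G x~x₁)
    ...   | y , x~y , x₁∤y = inj₂ (claw-heavy-pair H x~x₁ x~x₂ x~y x₁≢x₂ x₁≁x₂
              (¬same⇒far (adj⇒≢ G x~x₁) (adj⇒≢ G x~y) x₁∤y)
              (¬same⇒far (adj⇒≢ G x~x₂) (adj⇒≢ G x~y) (x₁∤y ∘ (x₁⇝x₂ ++ʷ_))))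

lemma2 : ∀ {n : ℕ} (G : Graph n) → Connected G → ClawO-1Heavy G →
    (x : Fin n) → CutVertex G x →
    TwoComponentsMinus G x ×
    (∀ x₁ x₂ → x₁ ≢ x₂ → Adj G x x₁ → Adj G x x₂ → SameCompMinus G x x₁ x₂ →
      Adj G x₁ x₂ ⊎ Heavy G x₁ x₂)
lemma2 G conn H x (u , v , u≢x , v≢x , u∤v)
  with walk-to-neighbour G u≢x (conn u x) | walk-to-neighbour G v≢x (conn v x)
... | a , x~a , u⇝a | b , x~b , v⇝b =
  (a , b , adj⇒≢ G x~a , adj⇒≢ G x~b , a∤b , side) , adjacent-or-heavy
  where
  a∤b : ¬ SameCompMinus G x a b
  a∤b a⇝b = u∤v (u⇝a ++ʷ a⇝b ++ʷ walk-reverse v⇝b)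
  open Sides G H conn x~a x~b a∤b
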